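{- Let $G=(V,E)$ be a finite graph and let $A^c$ be its complemented adjacency matrix. For every $J\subseteq V$ the following conditions are equivalent: (i) the column vectors $A^c[V,j]$ $(j\in J)$ are independent; (ii) $J$ has a witness in $A^c$; (iii) $\mathrm{ht}\,\widehat{\mathcal S_J}=|J|$, where $\widehat{\mathcal S_J}=\{\mathrm{St}(J')\mid J'\subseteq J\}$ ordered by inclusion; (iv) $J$ is a transversal of the partition of successive differences for some chain of $\mathrm{Fl}\,G$; (v) $J$ is a partial transversal of the partition of successive differences for some maximal chain of $\mathrm{Fl}\,G$.
   Context: Graphs are finite, undirected, without loops or multiple edges. For $v\in V$, $\mathrm{St}(v)$ is the set of vertices adjacent to $v$; for $W\subseteq V$, $\mathrm{St}(W)=\bigcap_{w\in W}\mathrm{St}(w)$, with $\mathrm{St}(\emptyset)=V$. $\mathrm{Fl}\,G=\{\mathrm{St}(W)\mid W\subseteq V\}$, ordered by inclusion (the lattice of flats). The height $\mathrm{ht}\,P$ of a finite poset $P$ is the maximum $k$ such that there is a chain $p_0<p_1<\dots<p_k$ in $P$. $A^c$ is the $V\times V$ boolean matrix whose $(i,j)$ entry is $0$ if $\{i,j\}\in E$ and $1$ otherwise (so diagonal entries are $1$); $A^c[I,J]$ denotes the submatrix with rows in $I$ and columns in $J$. The superboolean semiring $\mathbb{SB}=\{0,1,1^\nu\}$ has addition $0+x=x$, $1+1=1^\nu$, $1^\nu+x=1^\nu$ for all $x$, and multiplication $0\cdot x=0$, $1\cdot1=1$, $1\cdot1^\nu=1^\nu\cdot1^\nu=1^\nu$.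 Vectors $C_1,\dots,C_m\in\mathbb{SB}^n$ are dependent if there are $\lambda_1,\dots,\lambda_m\in\{0,1\}$, not all zero, such that every coordinate of $\lambda_1C_1+\dots+\lambda_mC_m$ lies in $\{0,1^\nu\}$; otherwise they are independent (boolean matrices are viewed as matrices over $\mathbb{SB}$). A square boolean matrix is nonsingular if by permuting its rows and permuting its columns independently it can be brought to lower triangular form with all diagonal entries $1$ and all entries above the diagonal $0$. $J$ has a witness in $A^c$ if there is $I\subseteq V$ with $|I|=|J|$ and $A^c[I,J]$ nonsingular. For a chain $X_0\supset X_1\supset\dots\supset X_k$ of subsets, a set $\{y_1,\dots,y_k\}$ is a transversal of the partition of successive differences if $y_i\in X_{i-1}\setminus X_i$ for $i=1,\dots,k$; a partial transversal is a subset of a transversal. -}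

module Defs where

open import Data.Nat using (ℕ; zero; suc; _≤_)
open import Data.Bool using (Bool; true; false; not; _∧_; _∨_)
open import Data.Fin using (Fin; inject₁; _<_) renaming (zero to fzero; suc to fsuc)
open import Data.Fin.Subset using (Subset; _∈_; _∉_; _⊆_; _⊂_; ∣_∣)
open import Data.Vec using (tabulate; lookup)
open import Data.Product using (Σ; ∃; _×_; _,_)
open import Data.Sum using (_⊎_)
open import Relation.Binary.PropositionalEquality using (_≡_)
open import Relation.Nullary using (¬_)
open import Function.Definitions using (Injective)

record Graph (n : ℕ) : Set where
  field
    adj   : Fin n → Fin n → Bool
    sym   : ∀ i j → adj i j ≡ adj j i
    irrefl : ∀ i → adj i i ≡ false
open Graph public

allFin : ∀ {n} → (Fin n → Bool) → Bool
allFin {zero}  f = true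
allFin {suc n} f = f fzero ∧ allFin (λ i → f (fsuc i))

-- St(W) = ⋂_{w ∈ W} St(w), with St(∅) = V, St(w) = neighbours of w
St : ∀ {n} → Graph n → Subset n → Subset n
St G W = tabulate (λ u → allFin (λ w → not (lookup W w) ∨ adj G w u))

IsFlat : ∀ {n} → Graph n → Subset n → Set
IsFlat G X = ∃ λ (W : Subset _) → St G W ≡ X

Ac : ∀ {n} → Graph n → Fin n → Fin n → Bool
Ac G i j = not (adj G i j)

data SB : Set where
  𝟘 𝟙 𝟙ν : SB

infixl 6 _⊕_
infixl 7 _⊗_

_⊕_ : SB → SB → SB
𝟘  ⊕ x = x
𝟙  ⊕ 𝟘 = 𝟙
𝟙  ⊕ 𝟙 = 𝟙ν
𝟙  ⊕ 𝟙ν = 𝟙ν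
𝟙ν ⊕ x = 𝟙ν

_⊗_ : SB → SB → SB
𝟘  ⊗ x = 𝟘
𝟙  ⊗ 𝟘 = 𝟘
𝟙  ⊗ 𝟙 = 𝟙
𝟙  ⊗ 𝟙ν = 𝟙ν
𝟙ν ⊗ 𝟘 = 𝟘
𝟙ν ⊗ 𝟙 = 𝟙ν
𝟙ν ⊗ 𝟙ν = 𝟙ν

toSB : Bool → SB
toSB false = 𝟘
toSB true  = 𝟙

sumSB : ∀ {n} → (Fin n → SB) → SB
sumSB {zero}  f = 𝟘
sumSB {suc n} f = f fzero ⊕ sumSB (λ i → f (fsuc i))

-- the columns A^c[V,j] (j ∈ J) are dependent over SB:
-- coefficients λ_j ∈ {0,1} (j ∈ J), not all zero, such that every
-- coordinate of Σ_{j∈J} λ_j · A^c[V,j] lies in {0, 1^ν}.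
ColumnsDependent : ∀ {n} → Graph n → Subset n → Set
ColumnsDependent {n} G J =
  Σ (Fin n → Bool) λ λc →
    (∃ λ j → j ∈ J × λc j ≡ true) ×
    (∀ i → let s = sumSB (λ j → toSB (lookup J j) ⊗ (toSB (λc j) ⊗ toSB (Ac G i j)))
           in s ≡ 𝟘 ⊎ s ≡ 𝟙ν)

ColumnsIndependent : ∀ {n} → Graph n → Subset n → Set
ColumnsIndependent G J = ¬ ColumnsDependent G J

-- Nonsingularity of the square submatrix M[I,J] of a boolean matrix M:
-- enumerations r of I and c of J (i.e. orderings = permutations of rows
-- and columns) making it lower triangular with 1's on the diagonal.

EnumeratesSubset : ∀ {n m} → (Fin m → Fin n) → Subset n → Set
EnumeratesSubset {n} e X = Injective _≡_ _≡_ e × (∀ v → (v ∈ X → ∃ λ a → e a ≡ v) × (∀ a → e a ≡ v → v ∈ X))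

NonsingularSub : ∀ {n} → (Fin n → Fin n → Bool) → Subset n → Subset n → Set
NonsingularSub {n} M I J =
  Σ ℕ λ m → Σ (Fin m → Fin n) λ r → Σ (Fin m → Fin n) λ c →
    EnumeratesSubset r I × EnumeratesSubset c J ×
    (∀ a → M (r a) (c a) ≡ true) ×
    (∀ a b → a < b → M (r a) (c b) ≡ false)

HasWitness : ∀ {n} → Graph n → Subset n → Set
HasWitness G J = ∃ λ I → ∣ I ∣ ≡ ∣ J ∣ × NonsingularSub (Ac G) I J

HasChainOfLength : ∀ {n} → (Subset n → Set) → ℕ → Set
HasChainOfLength {n} P k =
  Σ (Fin (suc k) → Subset n) λ p →
    (∀ i → P (p i)) × (∀ (i : Fin k) → p (inject₁ i) ⊂ p (fsuc i))

HeightIs : ∀ {n} → (Subset n → Set) → ℕ → Set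
HeightIs P k = HasChainOfLength P k × (∀ m → HasChainOfLength P m → m ≤ k)

SJ : ∀ {n} → Graph n → Subset n → Subset n → Set
SJ G J X = ∃ λ J' → J' ⊆ J × St G J' ≡ X

IsFlatChain : ∀ {n} → Graph n → (k : ℕ) → (Fin (suc k) → Subset n) → Set
IsFlatChain G k X = (∀ i → IsFlat G (X i)) × (∀ (i : Fin k) → X (fsuc i) ⊂ X (inject₁ i))

IsMaximalFlatChain : ∀ {n} → Graph n → (k : ℕ) → (Fin (suc k) → Subset n) → Set
IsMaximalFlatChain {n} G k X =
  IsFlatChain G k X ×
  (∀ (l : ℕ) (Y : Fin (suc l) → Subset n) → IsFlatChain G l Y →
     (∀ i → ∃ λ j → Y j ≡ X i) → ∀ j → ∃ λ i → X i ≡ Y j)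

IsTransversalFn : ∀ {n} (k : ℕ) → (Fin (suc k) → Subset n) → (Fin k → Fin n) → Set
IsTransversalFn k X y = ∀ i → y i ∈ X (inject₁ i) × y i ∉ X (fsuc i)

IsImage : ∀ {n k} → (Fin k → Fin n) → Subset n → Set
IsImage y J = ∀ v → (v ∈ J → ∃ λ i → y i ≡ v) × (∀ i → y i ≡ v → v ∈ J)

IsTransversal : ∀ {n} (k : ℕ) → (Fin (suc k) → Subset n) → Subset n → Set
IsTransversal {n} k X J = Σ (Fin k → Fin n) λ y → IsTransversalFn k X y × IsImage y J

IsPartialTransversal : ∀ {n} (k : ℕ) → (Fin (suc k) → Subset n) → Subset n → Set
IsPartialTransversal {n} k X J = Σ (Subset n) λ T → IsTransversal k X T × J ⊆ T

-- All five
-- conditions are compared with one notion, a triangular system for J: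
-- an ordering c₁,…,c_m of J and rows r₁,…,r_m with A^c[r_a,c_a] = 1 and
-- A^c[r_a,c_b] = 0 for a < b.
--  (i)   For any Boolean matrix, triangular columns are independent over SB, and
--        an independent J has a row meeting exactly one of its columns, which is
--        peeled off by induction on J.
--  (ii)  A witness is a triangular system together with its set of rows.
--  (iii) The stars of the suffixes {c_a,…,c_m} form a chain of length |J| in Ŝ_J;
--        conversely J ∩ St(P) strictly shrinks along any chain in Ŝ_J, which
--        bounds its length by |J| and yields a triangular system at length |J|.
--  (iv)  The stars of the prefixes {r₁,…,r_a} form a chain of flats transversed
--        by the c_a; conversely a transversal of a chain of flats gives rows.
--  (v)   Inserting flats into a transversed chain of flats while possible gives
--        a maximal chain still separating the elements of J, hence J is a
--        partial transversal; conversely J lies in a transversal as in (iv).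
module Submission where

open import Defs
open import Data.Nat using (ℕ; suc)
open import Data.Fin using (Fin)
open import Data.Fin.Subset using (Subset; ∣_∣)
open import Data.Product using (_×_; Σ; ∃)
open import Function.Bundles using (_⇔_; mk⇔)

open import Level using (0ℓ)
open import Function using (_∘_)
open import Function.Definitions using (Injective)
open import Data.Empty using (⊥-elim)
open import Data.Unit using (⊤; tt)
open import Data.Product using (_,_; proj₁; proj₂)
open import Data.Sum as Sum using (_⊎_; inj₁; inj₂)
open import Data.Bool as Bool using (Bool; true; false; not; _∧_; _∨_)
open import Data.Bool.Properties using (∧-conicalˡ; ∧-conicalʳ; ∧-zeroʳ)
import Data.Nat as ℕ
import Data.Nat.Properties as ℕ
open import Data.Fin as Fin using (_<_; _≟_; toℕ; inject₁; punchIn; punchOut) renaming (zero to fzero; suc to fsuc)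
import Data.Fin.Properties as Fin
open import Data.Fin.Properties using (any?; <-cmp)
open import Data.Fin.Induction using (<-wellFounded)
open import Data.Fin.Subset using (_∈_; _∉_; _⊆_; _⊂_; _∩_; _─_; _-_; inside; outside)
open import Data.Fin.Subset.Properties using (_∈?_; _⊂?_; anySubset?; ∣p∣≤n; drop-there; ⊂-⊆-trans; p⊂q⇒∣p∣<∣q∣; p⊆q⇒∣p∣≤∣q∣; x∈p∩q⁺; x∈p∩q⁻; p─q⊆p; x∈p⇒p-x⊂p; x∈p∧x≢y⇒x∈p-y; x∈⁅x⁆)
open import Data.Fin.Subset.Induction using (⊂-wellFounded)
open import Data.List using (List; []; _∷_; length) renaming (lookup to lookupˡ; tabulate to tabulateˡ)
open import Data.List.Membership.Propositional using () renaming (_∈_ to _∈ˡ_)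
open import Data.List.Membership.Propositional.Properties using (∈-lookup; ∈-tabulate⁺; ∈-tabulate⁻)
open import Data.List.Relation.Unary.All as All using (All; _∷_; all?)
open import Data.List.Relation.Unary.Any using (index; here; there)
open import Data.List.Relation.Unary.Any.Properties using (lookup-index)
open import Data.List.Relation.Unary.Linked using (Linked; []; [-]; _∷_)
open import Data.Vec using ([]; _∷_; lookup; tabulate; here; there)
open import Data.Vec.Properties using (lookup∘tabulate; []=⇒lookup; lookup⇒[]=; ≡-dec)
open import Induction.WellFounded as WF using (WfRec)
open import Relation.Binary.Definitions using (tri<; tri≈; tri>)
open import Relation.Binary.PropositionalEquality as ≡ using (_≡_; _≢_; refl; trans; cong; cong₂; subst; subst₂)
open import Relation.Nullary using (¬_; ¬?; Dec; yes; no; does; contradiction)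
open import Relation.Nullary.Decidable using (_×-dec_; _⊎-dec_; dec-true)
open import Relation.Unary using (Pred; Decidable)

clash : ∀ {b} → b ≡ true → b ≡ false → ∀ {A : Set} → A
clash refl ()

⟦_⟧ : ∀ {n} {P : Pred (Fin n) 0ℓ} → Decidable P → Subset n
⟦ P? ⟧ = tabulate (λ x → does (P? x))

∈⟦⟧⁺ : ∀ {n} {P : Pred (Fin n) 0ℓ} (P? : Decidable P) {x} → P x → x ∈ ⟦ P? ⟧
∈⟦⟧⁺ P? {x} px = lookup⇒[]= x _ (trans (lookup∘tabulate _ x) (dec-true (P? x) px))

∈⟦⟧⁻ : ∀ {n} {P : Pred (Fin n) 0ℓ} (P? : Decidable P) {x} → x ∈ ⟦ P? ⟧ → P x
∈⟦⟧⁻ P? {x} x∈ with P? x | trans (≡.sym (lookup∘tabulate (λ y → does (P? y)) x)) ([]=⇒lookup x∈)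
... | yes px | _ = px
... | no _   | ()

imageWhere : ∀ {n m} {Q : Pred (Fin m) 0ℓ} → (Fin m → Fin n) → Decidable Q → Subset n
imageWhere e Q? = ⟦ (λ v → any? (λ a → (e a ≟ v) ×-dec Q? a)) ⟧

∈imageWhere⁺ : ∀ {n m} {Q : Pred (Fin m) 0ℓ} (e : Fin m → Fin n) (Q? : Decidable Q) {a} →
  Q a → e a ∈ imageWhere e Q?
∈imageWhere⁺ e Q? {a} qa = ∈⟦⟧⁺ (λ v → any? (λ a → (e a ≟ v) ×-dec Q? a)) (a , refl , qa)

∈imageWhere⁻ : ∀ {n m} {Q : Pred (Fin m) 0ℓ} (e : Fin m → Fin n) (Q? : Decidable Q) {v} →
  v ∈ imageWhere e Q? → ∃ λ a → e a ≡ v × Q a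
∈imageWhere⁻ e Q? = ∈⟦⟧⁻ (λ v → any? (λ a → (e a ≟ v) ×-dec Q? a))

∀-imageWhere : ∀ {n m} {Q : Pred (Fin m) 0ℓ} {P : Pred (Fin n) 0ℓ} (e : Fin m → Fin n) (Q? : Decidable Q) →
  (∀ {a} → Q a → P (e a)) → ∀ {v} → v ∈ imageWhere e Q? → P v
∀-imageWhere e Q? h v∈ with ∈imageWhere⁻ e Q? v∈
... | a , refl , qa = h qa

image : ∀ {n m} → (Fin m → Fin n) → Subset n
image e = imageWhere {Q = λ _ → ⊤} e (λ _ → yes tt)

∈image⁺ : ∀ {n m} (e : Fin m → Fin n) a → e a ∈ image e
∈image⁺ e a = ∈imageWhere⁺ e _ tt

∈image⁻ : ∀ {n m} (e : Fin m → Fin n) {v} → v ∈ image e → ∃ λ a → e a ≡ v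
∈image⁻ e v∈ = let (a , ea≡v , _) = ∈imageWhere⁻ e _ v∈ in a , ea≡v

image-is-image : ∀ {n m} (e : Fin m → Fin n) → IsImage e (image e)
image-is-image e v = ∈image⁻ e , λ a ea≡v → subst (_∈ image e) ea≡v (∈image⁺ e a)

∈─⇒∉ : ∀ {n} (p q : Subset n) {x} → x ∈ p ─ q → x ∉ q
∈─⇒∉ (inside ∷ p)  (outside ∷ q) here ()
∈─⇒∉ (_ ∷ p)       (_ ∷ q) (there x∈) (there x∈q) = ∈─⇒∉ p q x∈ x∈q

∈-⇒∈ : ∀ {n} {p : Subset n} {x y} → x ∈ p - y → x ∈ p
∈-⇒∈ {p = p} = p─q⊆p p _

∈-⇒≢ : ∀ {n} {p : Subset n} {x y} → x ∈ p - y → x ≢ y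
∈-⇒≢ {p = p} {y = y} x∈ refl = ∈─⇒∉ p _ x∈ (x∈⁅x⁆ y)

allFin⁺ : ∀ {n} (f : Fin n → Bool) → (∀ i → f i ≡ true) → allFin f ≡ true
allFin⁺ {ℕ.zero}  f h = refl
allFin⁺ {suc n} f h rewrite h fzero = allFin⁺ (f ∘ fsuc) (h ∘ fsuc)

allFin⁻ : ∀ {n} (f : Fin n → Bool) → allFin f ≡ true → ∀ i → f i ≡ true
allFin⁻ {suc n} f eq fzero    = ∧-conicalˡ _ _ eq
allFin⁻ {suc n} f eq (fsuc i) = allFin⁻ (f ∘ fsuc) (∧-conicalʳ _ _ eq) i

module Adjacency {n} (G : Graph n) where

  adj-sym : ∀ {i j b} → adj G i j ≡ b → adj G j i ≡ b
  adj-sym {i} {j} = trans (Graph.sym G j i)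

  Ac≡false⇒adj : ∀ {i j} → Ac G i j ≡ false → adj G i j ≡ true
  Ac≡false⇒adj {i} {j} e with adj G i j
  ... | true = refl

  Ac≡true⇒nonadj : ∀ {i j} → Ac G i j ≡ true → adj G i j ≡ false
  Ac≡true⇒nonadj {i} {j} e with adj G i j
  ... | false = refl

  adj⇒Ac≡false : ∀ {i j} → adj G i j ≡ true → Ac G i j ≡ false
  adj⇒Ac≡false = cong not

  nonadj⇒Ac≡true : ∀ {i j} → adj G i j ≡ false → Ac G i j ≡ true
  nonadj⇒Ac≡true = cong not

module Stars {n} (G : Graph n) where

  private
    star-vector : ∀ W u → lookup (St G W) u ≡ allFin (λ w → not (lookup W w) ∨ adj G w u)
    star-vector W u = lookup∘tabulate _ u

  St⁺ : ∀ W u → (∀ {w} → w ∈ W → adj G w u ≡ true) → u ∈ St G W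
  St⁺ W u h = lookup⇒[]= u _ (trans (star-vector W u) (allFin⁺ _ pointwise))
    where
    pointwise : ∀ w → not (lookup W w) ∨ adj G w u ≡ true
    pointwise w with lookup W w in eq
    ... | false = refl
    ... | true  = h (lookup⇒[]= w W eq)

  St⁻ : ∀ {W u w} → u ∈ St G W → w ∈ W → adj G w u ≡ true
  St⁻ {W} {u} {w} u∈ w∈ with allFin⁻ _ (trans (≡.sym (star-vector W u)) ([]=⇒lookup u∈)) w
  ... | h rewrite []=⇒lookup w∈ = h

  St-out : ∀ W u → u ∉ St G W → ∃ λ w → w ∈ W × adj G w u ≡ false
  St-out W u u∉ with any? (λ w → (w ∈? W) ×-dec (adj G w u Bool.≟ false))
  ... | yes found = found
  ... | no none   = contradiction (St⁺ W u adjacent) u∉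
    where
    adjacent : ∀ {w} → w ∈ W → adj G w u ≡ true
    adjacent {w} w∈ with adj G w u in eq
    ... | true  = refl
    ... | false = contradiction (w , w∈ , eq) none

  St-antitone : ∀ {W W'} → W ⊆ W' → St G W' ⊆ St G W
  St-antitone {W} W⊆W' {u} u∈ = St⁺ W u (λ w∈ → St⁻ u∈ (W⊆W' w∈))

-- Superboolean sums.  A summand toSB b is 1 or 0, so a sum of such summands
-- is 0 exactly when all summands are 0, and 1 exactly when a single one is 1.

toSB-∧ : ∀ a b → toSB (a ∧ b) ≡ toSB a ⊗ toSB b
toSB-∧ false b     = refl
toSB-∧ true  false = refl
toSB-∧ true  true  = refl

sumSB-cong : ∀ {n} {f g : Fin n → SB} → (∀ i → f i ≡ g i) → sumSB f ≡ sumSB g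
sumSB-cong {ℕ.zero} h = refl
sumSB-cong {suc n}  h = cong₂ _⊕_ (h fzero) (sumSB-cong (h ∘ fsuc))

sumSB-zero : ∀ {n} (g : Fin n → Bool) → (∀ i → g i ≡ false) → sumSB (toSB ∘ g) ≡ 𝟘
sumSB-zero {ℕ.zero} g h = refl
sumSB-zero {suc n}  g h rewrite h fzero = sumSB-zero (g ∘ fsuc) (h ∘ fsuc)

sumSB-unit : ∀ {n} (g : Fin n → Bool) v → g v ≡ true → (∀ u → u ≢ v → g u ≡ false) →
  sumSB (toSB ∘ g) ≡ 𝟙
sumSB-unit {suc n} g fzero    gv h rewrite gv = cong (𝟙 ⊕_) (sumSB-zero (g ∘ fsuc) (λ u → h (fsuc u) λ ()))
sumSB-unit {suc n} g (fsuc v) gv h rewrite h fzero (λ ()) =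
  sumSB-unit (g ∘ fsuc) v gv (λ u u≢v → h (fsuc u) (u≢v ∘ Fin.suc-injective))

toSB⊕≡𝟘 : ∀ b s → toSB b ⊕ s ≡ 𝟘 → b ≡ false × s ≡ 𝟘
toSB⊕≡𝟘 false s  eq = refl , eq
toSB⊕≡𝟘 true  𝟘  ()
toSB⊕≡𝟘 true  𝟙  ()
toSB⊕≡𝟘 true  𝟙ν ()

sumSB-zero⁻ : ∀ {n} (g : Fin n → Bool) → sumSB (toSB ∘ g) ≡ 𝟘 → ∀ i → g i ≡ false
sumSB-zero⁻ {suc n} g eq fzero    = proj₁ (toSB⊕≡𝟘 (g fzero) _ eq)
sumSB-zero⁻ {suc n} g eq (fsuc i) = sumSB-zero⁻ (g ∘ fsuc) (proj₂ (toSB⊕≡𝟘 (g fzero) _ eq)) i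

sumSB-unit⁻ : ∀ {n} (g : Fin n → Bool) → sumSB (toSB ∘ g) ≡ 𝟙 →
  ∃ λ v → g v ≡ true × (∀ u → u ≢ v → g u ≡ false)
sumSB-unit⁻ {suc n} g eq with g fzero in g0 | sumSB (toSB ∘ g ∘ fsuc) in rest
... | false | 𝟙 = let (v , gv , others) = sumSB-unit⁻ (g ∘ fsuc) rest in
  fsuc v , gv , λ { fzero _ → g0 ; (fsuc u) u≢v → others u (u≢v ∘ cong fsuc) }
... | true  | 𝟘 = fzero , g0 , λ { fzero 0≢0 → contradiction refl 0≢0 ; (fsuc u) _ → sumSB-zero⁻ (g ∘ fsuc) rest u }
... | false | 𝟘  with () ← eq
... | false | 𝟙ν with () ← eq
... | true  | 𝟙  with () ← eq
... | true  | 𝟙ν with () ← eq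

Matrix : ℕ → ℕ → Set
Matrix p n = Fin p → Fin n → Bool

contributes : ∀ {p n} → Matrix p n → Subset n → (Fin n → Bool) → Fin p → Fin n → Bool
contributes M J λc i j = lookup J j ∧ (λc j ∧ M i j)

combination : ∀ {p n} → Matrix p n → Subset n → (Fin n → Bool) → Fin p → SB
combination M J λc i = sumSB (λ j → toSB (lookup J j) ⊗ (toSB (λc j) ⊗ toSB (M i j)))

combination-count : ∀ {p n} (M : Matrix p n) J λc i →
  combination M J λc i ≡ sumSB (toSB ∘ contributes M J λc i)
combination-count M J λc i = sumSB-cong λ j → begin
  toSB (lookup J j) ⊗ (toSB (λc j) ⊗ toSB (M i j)) ≡⟨ cong (toSB (lookup J j) ⊗_) (≡.sym (toSB-∧ (λc j) _)) ⟩
  toSB (lookup J j) ⊗ toSB (λc j ∧ M i j)          ≡⟨ ≡.sym (toSB-∧ (lookup J j) _) ⟩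
  toSB (contributes M J λc i j)                    ∎
  where open ≡.≡-Reasoning

IsGhost : SB → Set
IsGhost s = s ≡ 𝟘 ⊎ s ≡ 𝟙ν

ghost-or-unit : ∀ s → IsGhost s ⊎ s ≡ 𝟙
ghost-or-unit 𝟘  = inj₁ (inj₁ refl)
ghost-or-unit 𝟙  = inj₂ refl
ghost-or-unit 𝟙ν = inj₁ (inj₂ refl)

unit? : (s : SB) → Dec (s ≡ 𝟙)
unit? 𝟘  = no λ ()
unit? 𝟙  = yes refl
unit? 𝟙ν = no λ ()

-- The columns J of M are dependent; for M = A^c this is ColumnsDependent.
Dependent : ∀ {p n} → Matrix p n → Subset n → Set
Dependent {n = n} M J =
  Σ (Fin n → Bool) λ λc → (∃ λ j → j ∈ J × λc j ≡ true) × (∀ i → IsGhost (combination M J λc i))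

independent-⊆ : ∀ {p n} (M : Matrix p n) {J J'} → J' ⊆ J → ¬ Dependent M J → ¬ Dependent M J'
independent-⊆ M {J} {J'} J'⊆J indep (λc , (j , j∈J' , λj) , ghost) =
  indep (λc' , (j , J'⊆J j∈J' , λ'j) , λ i → subst IsGhost (same-row i) (ghost i))
  where
  λc' : _ → Bool
  λc' v = lookup J' v ∧ λc v
  λ'j : λc' j ≡ true
  λ'j rewrite []=⇒lookup j∈J' = λj
  same-contribution : ∀ i v → contributes M J' λc i v ≡ contributes M J λc' i v
  same-contribution i v with lookup J' v in inJ'
  ... | false = ≡.sym (∧-zeroʳ (lookup J v))
  ... | true rewrite []=⇒lookup (J'⊆J (lookup⇒[]= v J' inJ')) = refl
  same-row : ∀ i → combination M J' λc i ≡ combination M J λc' i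
  same-row i = trans (combination-count M J' λc i)
    (trans (sumSB-cong (cong toSB ∘ same-contribution i)) (≡.sym (combination-count M J λc' i)))

record IsTriangular {p n m} (M : Matrix p n) (r : Fin m → Fin p) (c : Fin m → Fin n) : Set where
  field
    diagonal : ∀ a → M (r a) (c a) ≡ true
    above    : ∀ a b → a < b → M (r a) (c b) ≡ false

  -- the unit diagonal separates both the rows and the columns
  rows-injective : Injective _≡_ _≡_ r
  rows-injective {a} {b} ra≡rb with <-cmp a b
  ... | tri≈ _ a≡b _ = a≡b
  ... | tri< a<b _ _ = clash (subst (λ i → M i (c b) ≡ true) (≡.sym ra≡rb) (diagonal b)) (above a b a<b)
  ... | tri> _ _ b<a = clash (subst (λ i → M i (c a) ≡ true) ra≡rb (diagonal a)) (above b a b<a)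

  cols-injective : Injective _≡_ _≡_ c
  cols-injective {a} {b} ca≡cb with <-cmp a b
  ... | tri≈ _ a≡b _ = a≡b
  ... | tri< a<b _ _ = clash (subst (λ j → M (r a) j ≡ true) ca≡cb (diagonal a)) (above a b a<b)
  ... | tri> _ _ b<a = clash (subst (λ j → M (r b) j ≡ true) (≡.sym ca≡cb) (diagonal b)) (above b a b<a)

-- A triangular system for the column set J: triangular rows and columns whose
-- columns enumerate J.  Every condition of the theorem is equivalent to its existence.
record Triangular {p n} (M : Matrix p n) (J : Subset n) : Set where
  field
    size         : ℕ
    row          : Fin size → Fin p
    col          : Fin size → Fin n
    col-enum     : EnumeratesSubset col J
    isTriangular : IsTriangular M row col
  open IsTriangular isTriangular public

  col∈J : ∀ a → col a ∈ J
  col∈J a = proj₂ (proj₂ col-enum (col a)) a refl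

  col-onto : ∀ {v} → v ∈ J → ∃ λ a → col a ≡ v
  col-onto {v} = proj₁ (proj₂ col-enum v)

module _ {p n} (M : Matrix p n) where

  -- Triangular columns are independent: in a dependence, the first column with
  -- coefficient 1 is the only contribution to its row, making that row sum 1.
  triangular⇒independent : ∀ {J} → Triangular M J → ¬ Dependent M J
  triangular⇒independent {J} T (λc , (j , j∈J , λj) , ghost) =
    let (a , ca≡j) = col-onto j∈J in clash (subst (λ v → λc v ≡ true) (≡.sym ca≡j) λj) (unused a)
    where
    open Triangular T

    step : ∀ a → WfRec _<_ (λ b → λc (col b) ≡ false) a → λc (col a) ≡ false
    step a earlier with λc (col a) in used
    ... | false = refl
    ... | true  = ⊥-elim (not-ghost (ghost (row a)))
      where
      hit : contributes M J λc (row a) (col a) ≡ true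
      hit rewrite []=⇒lookup (col∈J a) | used | diagonal a = refl

      only-hit : ∀ v → v ≢ col a → contributes M J λc (row a) v ≡ false
      only-hit v v≢ with lookup J v in v∈J
      ... | false = refl
      ... | true with col-onto (lookup⇒[]= v J v∈J)
      ...   | b , refl with <-cmp b a
      ...     | tri< b<a _ _ rewrite earlier b<a = refl
      ...     | tri≈ _ b≡a _ = contradiction (cong col b≡a) v≢
      ...     | tri> _ _ a<b rewrite above a b a<b = ∧-zeroʳ _

      unit : combination M J λc (row a) ≡ 𝟙
      unit = trans (combination-count M J λc (row a)) (sumSB-unit _ (col a) hit only-hit)

      not-ghost : ¬ IsGhost (combination M J λc (row a))
      not-ghost (inj₁ zero)  with () ← trans (≡.sym unit) zero
      not-ghost (inj₂ ghost) with () ← trans (≡.sym unit) ghost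

    unused : ∀ a → λc (col a) ≡ false
    unused = WF.All.wfRec <-wellFounded 0ℓ _ step

  record Pivot (J : Subset n) : Set where
    field
      prow   : Fin p
      pcol   : Fin n
      pcol∈J : pcol ∈ J
      hit    : M prow pcol ≡ true
      miss   : ∀ {v} → v ∈ J → v ≢ pcol → M prow v ≡ false

  -- A nonempty independent J has a pivot: otherwise every row of the sum of
  -- all columns of J is 0 or 1^ν, which is a dependence.
  independent⇒pivot : ∀ {J j} → ¬ Dependent M J → j ∈ J → Pivot J
  independent⇒pivot {J} {j} indep j∈J
    with any? (λ i → unit? (sumSB (toSB ∘ contributes M J (lookup J) i)))
  ... | no none = contradiction (lookup J , (j , j∈J , []=⇒lookup j∈J) , all-ghost) indep
    where
    all-ghost : ∀ i → IsGhost (combination M J (lookup J) i)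
    all-ghost i with ghost-or-unit (combination M J (lookup J) i)
    ... | inj₁ ghost = ghost
    ... | inj₂ unit  = contradiction (i , trans (≡.sym (combination-count M J (lookup J) i)) unit) none
  ... | yes (i , unit) with sumSB-unit⁻ _ unit
  ... | v , contributes-v , others = record
    { prow = i ; pcol = v
    ; pcol∈J = lookup⇒[]= v J (∧-conicalˡ (lookup J v) _ contributes-v)
    ; hit = ∧-conicalʳ (lookup J v) _ (∧-conicalʳ (lookup J v) _ contributes-v)
    ; miss = λ {u} u∈J u≢v → let no-contribution = others u u≢v in
        subst (λ b → b ∧ (b ∧ M i u) ≡ false) ([]=⇒lookup u∈J) no-contribution
    }

  peel : ∀ {J} (P : Pivot J) → Triangular M (J - Pivot.pcol P) → Triangular M J
  peel {J} P T = record
    { size = suc size ; row = row′ ; col = col′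
    ; col-enum = col′-injective , enumerates
    ; isTriangular = record { diagonal = diagonal′ ; above = above′ }
    }
    where
    open Pivot P
    open Triangular T

    row′ : Fin (suc size) → Fin p
    row′ fzero    = prow
    row′ (fsuc a) = row a
    col′ : Fin (suc size) → Fin n
    col′ fzero    = pcol
    col′ (fsuc a) = col a

    col∉pcol : ∀ a → col a ≢ pcol
    col∉pcol a = ∈-⇒≢ (col∈J a)

    col′-injective : Injective _≡_ _≡_ col′
    col′-injective {fzero}  {fzero}  _  = refl
    col′-injective {fzero}  {fsuc b} eq = contradiction (≡.sym eq) (col∉pcol b)
    col′-injective {fsuc a} {fzero}  eq = contradiction eq (col∉pcol a)
    col′-injective {fsuc a} {fsuc b} eq = cong fsuc (cols-injective eq)

    enumerates : ∀ v → (v ∈ J → ∃ λ a → col′ a ≡ v) × (∀ a → col′ a ≡ v → v ∈ J)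
    enumerates v = onto , into
      where
      onto : v ∈ J → ∃ λ a → col′ a ≡ v
      onto v∈J with v ≟ pcol
      ... | yes refl = fzero , refl
      ... | no v≢pcol = let (a , ca≡v) = col-onto (x∈p∧x≢y⇒x∈p-y v∈J v≢pcol) in fsuc a , ca≡v
      into : ∀ a → col′ a ≡ v → v ∈ J
      into fzero    refl = pcol∈J
      into (fsuc a) refl = ∈-⇒∈ (col∈J a)

    diagonal′ : ∀ a → M (row′ a) (col′ a) ≡ true
    diagonal′ fzero    = hit
    diagonal′ (fsuc a) = diagonal a

    above′ : ∀ a b → a < b → M (row′ a) (col′ b) ≡ false
    above′ fzero    (fsuc b) _         = miss (∈-⇒∈ (col∈J b)) (col∉pcol b)
    above′ (fsuc a) (fsuc b) (ℕ.s≤s a<b) = above a b a<b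

  empty-triangular : ∀ {J} → ¬ (∃ λ v → v ∈ J) → Triangular M J
  empty-triangular J-empty = record
    { size = 0 ; row = λ () ; col = λ ()
    ; col-enum = (λ {a} → ⊥-elim (Fin.¬Fin0 a)) , λ v → (λ v∈J → contradiction (v , v∈J) J-empty) , λ ()
    ; isTriangular = record { diagonal = λ () ; above = λ () }
    }

  -- Independent columns admit a triangular system: peel off pivots, by
  -- well-founded induction on J ordered by strict inclusion.
  independent⇒triangular : ∀ J → ¬ Dependent M J → Triangular M J
  independent⇒triangular = WF.All.wfRec ⊂-wellFounded 0ℓ _ step
    where
    step : ∀ J → WfRec _⊂_ (λ J → ¬ Dependent M J → Triangular M J) J → ¬ Dependent M J → Triangular M J
    step J smaller indep with any? (_∈? J)
    ... | no J-empty = empty-triangular J-empty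
    ... | yes (j , j∈J) = peel P (smaller (x∈p⇒p-x⊂p pcol∈J) (independent-⊆ M ∈-⇒∈ indep))
      where
      P : Pivot J
      P = independent⇒pivot indep j∈J
      open Pivot P

enumerates-lowered : ∀ {n m} {X : Subset n} (e : Fin m → Fin (suc n)) (positive : ∀ a → fzero ≢ e a) →
  Injective _≡_ _≡_ e →
  (∀ v → (v ∈ X → ∃ λ a → e a ≡ fsuc v) × (∀ a → e a ≡ fsuc v → v ∈ X)) →
  EnumeratesSubset (λ a → punchOut (positive a)) X
enumerates-lowered e positive e-injective values =
  (λ eq → e-injective (Fin.punchOut-injective (positive _) (positive _) eq)) ,
  λ v → (λ v∈X → let (a , ea≡v) = proj₁ (values v) v∈X in
                  a , Fin.suc-injective (trans (Fin.punchIn-punchOut (positive a)) ea≡v)) ,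
        (λ a lowered≡v → proj₂ (values v) a (trans (≡.sym (Fin.punchIn-punchOut (positive a))) (cong fsuc lowered≡v)))

enumeration-size : ∀ {n m} (e : Fin m → Fin n) (X : Subset n) → EnumeratesSubset e X → ∣ X ∣ ≡ m
enumeration-size {ℕ.zero} {ℕ.zero}  e [] _ = refl
enumeration-size {ℕ.zero} {suc m}   e [] _ = ⊥-elim (Fin.¬Fin0 (e fzero))
enumeration-size {suc n} e (outside ∷ X) (e-injective , enum) =
  enumeration-size _ X (enumerates-lowered e positive e-injective values)
  where
  positive : ∀ a → fzero ≢ e a
  positive a 0≡ea with () ← proj₂ (enum fzero) a (≡.sym 0≡ea)
  values : ∀ v → (v ∈ X → ∃ λ a → e a ≡ fsuc v) × (∀ a → e a ≡ fsuc v → v ∈ X)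
  values v = (λ v∈X → proj₁ (enum (fsuc v)) (there v∈X)) , λ a eq → drop-there (proj₂ (enum (fsuc v)) a eq)
enumeration-size {suc n} {ℕ.zero} e (inside ∷ X) (_ , enum) = ⊥-elim (Fin.¬Fin0 (proj₁ (proj₁ (enum fzero) here)))
enumeration-size {suc n} {suc m} e (inside ∷ X) (e-injective , enum) =
  cong suc (enumeration-size _ X (enumerates-lowered (e ∘ punchIn a₀) positive
    (λ eq → Fin.punchIn-injective a₀ _ _ (e-injective eq)) values))
  where
  -- a₀ is the index of the vertex 0, which is removed from the domain
  a₀ : Fin (suc m)
  a₀ = proj₁ (proj₁ (enum fzero) here)
  ea₀≡0 : e a₀ ≡ fzero
  ea₀≡0 = proj₂ (proj₁ (enum fzero) here)
  positive : ∀ a → fzero ≢ e (punchIn a₀ a)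
  positive a 0≡e = Fin.punchInᵢ≢i a₀ a (e-injective (trans (≡.sym 0≡e) (≡.sym ea₀≡0)))
  values : ∀ v → (v ∈ X → ∃ λ a → e (punchIn a₀ a) ≡ fsuc v) × (∀ a → e (punchIn a₀ a) ≡ fsuc v → v ∈ X)
  values v = onto , λ a eq → drop-there (proj₂ (enum (fsuc v)) _ eq)
    where
    onto : v ∈ X → ∃ λ a → e (punchIn a₀ a) ≡ fsuc v
    onto v∈X with proj₁ (enum (fsuc v)) (there v∈X)
    ... | a , ea≡v = punchOut a₀≢a , trans (cong e (Fin.punchIn-punchOut a₀≢a)) ea≡v
      where
      a₀≢a : a₀ ≢ a
      a₀≢a refl with () ← trans (≡.sym ea₀≡0) ea≡v

image-enumerates : ∀ {n m} (e : Fin m → Fin n) → Injective _≡_ _≡_ e → EnumeratesSubset e (image e)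
image-enumerates e e-injective = e-injective , image-is-image e

injective-onto : ∀ {n} {J : Subset n} (e : Fin ∣ J ∣ → Fin n) → Injective _≡_ _≡_ e → (∀ a → e a ∈ J) →
  ∀ {v} → v ∈ J → ∃ λ a → e a ≡ v
injective-onto {J = J} e e-injective e∈J {v} v∈J with any? (λ a → e a ≟ v)
... | yes hit = hit
... | no miss = ⊥-elim (ℕ.<-irrefl image-size (p⊂q⇒∣p∣<∣q∣ image⊂J))
  where
  image-size : ∣ image e ∣ ≡ ∣ J ∣
  image-size = enumeration-size e (image e) (image-enumerates e e-injective)
  image⊂J : image e ⊂ J
  image⊂J = (λ u∈ → let (a , ea≡u) = ∈image⁻ e u∈ in subst (_∈ J) ea≡u (e∈J a)) ,
            v , v∈J , λ v∈ → miss (∈image⁻ e v∈)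

-- (ii) For a square matrix, a nonsingular M[I,J] with |I| = |J| is exactly a
-- triangular system for J together with the set of its rows.
module _ {n} (M : Matrix n n) {J : Subset n} where

  -- (a witness directly lists a triangular system; conversely the rows of a
  --  triangular system are distinct, so they form a set of size |J|)
  witness⇒triangular : (∃ λ I → ∣ I ∣ ≡ ∣ J ∣ × NonsingularSub M I J) → Triangular M J
  witness⇒triangular (_ , _ , m , r , c , _ , c-enum , diagonal , above) = record
    { size = m ; row = r ; col = c ; col-enum = c-enum
    ; isTriangular = record { diagonal = diagonal ; above = above } }

  triangular⇒witness : Triangular M J → ∃ λ I → ∣ I ∣ ≡ ∣ J ∣ × NonsingularSub M I J
  triangular⇒witness T =
    image row , same-size , size , row , col , row-enum , col-enum , diagonal , above
    where
    open Triangular T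
    row-enum : EnumeratesSubset row (image row)
    row-enum = image-enumerates row rows-injective
    same-size : ∣ image row ∣ ≡ ∣ J ∣
    same-size = trans (enumeration-size row _ row-enum) (≡.sym (enumeration-size col J col-enum))

-- a < b among step indices means step a ends no later than step b starts.
<⇒suc≤inject₁ : ∀ {k} {a b : Fin k} → a < b → fsuc a Fin.≤ inject₁ b
<⇒suc≤inject₁ {b = b} a<b = subst (ℕ._≤_ _) (≡.sym (Fin.toℕ-inject₁ b)) a<b

antitone : ∀ {n k} (X : Fin (suc k) → Subset n) → (∀ i → X (fsuc i) ⊆ X (inject₁ i)) →
  ∀ {a b} → a Fin.≤ b → X b ⊆ X a
antitone X steps {fzero} {fzero} _ = λ x∈ → x∈
antitone {k = suc k} X steps {fzero}  {fsuc b} _ = steps fzero ∘ antitone (X ∘ fsuc) (steps ∘ fsuc) {fzero} {b} ℕ.z≤n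
antitone {k = suc k} X steps {fsuc a} {fsuc b} (ℕ.s≤s a≤b) = antitone (X ∘ fsuc) (steps ∘ fsuc) a≤b

strictly-antitone : ∀ {n k} (X : Fin (suc k) → Subset n) → (∀ i → X (fsuc i) ⊂ X (inject₁ i)) →
  ∀ {a b} → a < b → X b ⊂ X a
strictly-antitone X steps {a} {fsuc b} (ℕ.s≤s a≤b) =
  ⊂-⊆-trans (steps b) (antitone X (proj₁ ∘ steps) (subst (ℕ._≤_ _) (≡.sym (Fin.toℕ-inject₁ b)) a≤b))

countdown : ∀ {k} (f : Fin (suc k) → ℕ) → (∀ i → f (fsuc i) ℕ.< f (inject₁ i)) → k ℕ.≤ f fzero
countdown {ℕ.zero}  f steps = ℕ.z≤n
countdown {suc k}   f steps = ℕ.≤-trans (ℕ.s≤s (countdown (f ∘ fsuc) (steps ∘ fsuc))) (steps fzero)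

-- Separating chains.  Refining a chain of flats keeps every element of J in
-- its own step; this is tracked by the following notion.
module _ {n : ℕ} where

  Splits : Subset n → Fin n → Fin n → Set
  Splits Z j j' = (j ∈ Z × j' ∉ Z) ⊎ (j' ∈ Z × j ∉ Z)

  Separates : (Subset n → Set) → Subset n → Set
  Separates Member J =
    (∀ {j} → j ∈ J → (∃ λ Z → Member Z × j ∈ Z) × (∃ λ Z → Member Z × j ∉ Z)) ×
    (∀ {j j'} → j ∈ J → j' ∈ J → j ≢ j' → ∃ λ Z → Member Z × Splits Z j j')

  separates-mono : ∀ {Member Member' : Subset n → Set} {J} → (∀ {Z} → Member Z → Member' Z) →
    Separates Member J → Separates Member' J
  separates-mono into (reach , split) =
    (λ j∈J → let ((Z , m , j∈Z) , (Z' , m' , j∉Z')) = reach j∈J in (Z , into m , j∈Z) , (Z' , into m' , j∉Z')) ,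
    (λ j∈J j'∈J j≢j' → let (Z , m , s) = split j∈J j'∈J j≢j' in Z , into m , s)

  InChain : ∀ {k} → (Fin (suc k) → Subset n) → Subset n → Set
  InChain X Z = ∃ λ i → X i ≡ Z

  -- A decreasing chain separates each of its transversals: y_i is inside
  -- X_i and outside X_{i+1}, which contains every later y_b.
  transversal-separated : ∀ {k J} (X : Fin (suc k) → Subset n) → (∀ i → X (fsuc i) ⊆ X (inject₁ i)) →
    IsTransversal k X J → Separates (InChain X) J
  transversal-separated X decreasing (y , transversal , y-image) = reach , split
    where
    split-later : ∀ {a b} → a < b → Splits (X (fsuc a)) (y a) (y b)
    split-later a<b = inj₂ (antitone X decreasing (<⇒suc≤inject₁ a<b) (proj₁ (transversal _)) , proj₂ (transversal _))
    swap : ∀ {Z j j'} → Splits Z j j' → Splits Z j' j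
    swap (inj₁ s) = inj₂ s
    swap (inj₂ s) = inj₁ s
    reach : ∀ {j} → j ∈ _ → (∃ λ Z → InChain X Z × j ∈ Z) × (∃ λ Z → InChain X Z × j ∉ Z)
    reach j∈J with proj₁ (y-image _) j∈J
    ... | i , refl = (X (inject₁ i) , (_ , refl) , proj₁ (transversal i)) , (X (fsuc i) , (_ , refl) , proj₂ (transversal i))
    split : ∀ {j j'} → j ∈ _ → j' ∈ _ → j ≢ j' → ∃ λ Z → InChain X Z × Splits Z j j'
    split j∈J j'∈J j≢j' with proj₁ (y-image _) j∈J | proj₁ (y-image _) j'∈J
    ... | a , refl | b , refl with <-cmp a b
    ... | tri< a<b _ _ = X (fsuc a) , (_ , refl) , split-later a<b
    ... | tri≈ _ refl _ = contradiction refl j≢j'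
    ... | tri> _ _ b<a = X (fsuc b) , (_ , refl) , swap (split-later b<a)

  InStep : ∀ {k} → (Fin (suc k) → Subset n) → Fin k → Fin n → Set
  InStep X i v = v ∈ X (inject₁ i) × v ∉ X (fsuc i)

  leaves : ∀ {k} (X : Fin (suc k) → Subset n) {j} → j ∈ X fzero → ∀ b → j ∉ X b → ∃ λ i → InStep X i j
  leaves {ℕ.zero} X j∈X₀ fzero j∉ = contradiction j∈X₀ j∉
  leaves {suc k}  X {j} j∈X₀ b j∉ with j ∈? X (fsuc fzero)
  ... | no j∉X₁ = fzero , j∈X₀ , j∉X₁
  ... | yes j∈X₁ with b
  ...   | fzero   = contradiction j∈X₀ j∉
  ...   | fsuc b' = let (i , j-in , j-out) = leaves (X ∘ fsuc) j∈X₁ b' j∉ in fsuc i , j-in , j-out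

  same-step : ∀ {k} (X : Fin (suc k) → Subset n) → (∀ i → X (fsuc i) ⊆ X (inject₁ i)) →
    ∀ {i u v} → InStep X i u → InStep X i v → ∀ l → u ∈ X l → v ∈ X l
  same-step X decreasing {i} (_ , u-out) (v-in , _) l u∈ with toℕ l ℕ.≤? toℕ i
  ... | yes l≤i = antitone X decreasing (subst (ℕ._≤_ _) (≡.sym (Fin.toℕ-inject₁ i)) l≤i) v-in
  ... | no  l≰i = contradiction (antitone X decreasing (ℕ.≰⇒> l≰i) u∈) u-out

  -- A strictly decreasing chain separating J has J as a partial transversal:
  -- choose in each step X_i \ X_{i+1} an element, one from J when possible.
  -- Each j ∈ J leaves the chain at some step, and the element chosen there is
  -- j itself, since no member splits two elements of the same step.
  separated⇒partial-transversal : ∀ {k J} (X : Fin (suc k) → Subset n) →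
    (∀ i → X (fsuc i) ⊂ X (inject₁ i)) → Separates (InChain X) J → IsPartialTransversal k X J
  separated⇒partial-transversal {k} {J} X decreasing (reach , split) =
    image y , (y , y-transversal , image-is-image y) , J⊆image
    where
    decreasing⊆ : ∀ i → X (fsuc i) ⊆ X (inject₁ i)
    decreasing⊆ = proj₁ ∘ decreasing
    choose : ∀ i → Σ (Fin n) λ v → InStep X i v × (∀ {j} → j ∈ J → InStep X i j → v ∈ J)
    choose i with any? (λ v → (v ∈? J) ×-dec ((v ∈? X (inject₁ i)) ×-dec ¬? (v ∈? X (fsuc i))))
    ... | yes (v , v∈J , step) = v , step , λ _ _ → v∈J
    ... | no none = let (_ , v , v-in , v-out) = decreasing i in
      v , (v-in , v-out) , λ j∈J step → contradiction (_ , j∈J , step) none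
    y : Fin k → Fin n
    y i = proj₁ (choose i)
    y-transversal : ∀ i → InStep X i (y i)
    y-transversal i = proj₁ (proj₂ (choose i))
    chosen : ∀ {j} i → j ∈ J → InStep X i j → y i ≡ j
    chosen {j} i j∈J j-step with y i ≟ j
    ... | yes yi≡j = yi≡j
    ... | no yi≢j with split (proj₂ (proj₂ (choose i)) j∈J j-step) j∈J yi≢j
    ...   | _ , (l , refl) , inj₁ (yi∈ , j∉) = contradiction (same-step X decreasing⊆ (y-transversal i) j-step l yi∈) j∉
    ...   | _ , (l , refl) , inj₂ (j∈ , yi∉) = contradiction (same-step X decreasing⊆ j-step (y-transversal i) l j∈) yi∉
    J⊆image : J ⊆ image y
    J⊆image {j} j∈J with reach j∈J
    ... | (_ , (a , refl) , j∈Xa) , (_ , (b , refl) , j∉Xb) =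
      let (i , j-step) = leaves X (antitone X decreasing⊆ ℕ.z≤n j∈Xa) b j∉Xb in
      subst (_∈ image y) (chosen i j∈J j-step) (∈image⁺ y i)

module _ {n : ℕ} where

  Descending : List (Subset n) → Set
  Descending = Linked (λ X Y → Y ⊂ X)

  Comparable : Subset n → Subset n → Set
  Comparable C Z = C ⊂ Z ⊎ Z ⊂ C

  comparable? : ∀ C Z → Dec (Comparable C Z)
  comparable? C Z = (C ⊂? Z) ⊎-dec (Z ⊂? C)

  insert : Subset n → List (Subset n) → List (Subset n)
  insert C [] = C ∷ []
  insert C (x ∷ xs) with x ⊂? C
  ... | yes _ = C ∷ x ∷ xs
  ... | no  _ = x ∷ insert C xs

  private
    above-of : ∀ {C x} → Comparable C x → ¬ x ⊂ C → C ⊂ x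
    above-of (inj₁ C⊂x) _   = C⊂x
    above-of (inj₂ x⊂C) x⊄C = contradiction x⊂C x⊄C

  -- Inserting a set comparable with all entries keeps a list descending;
  -- insert-below covers insertion behind the head x, where C ⊂ x.
  insert-below : ∀ {C x xs} → Descending (x ∷ xs) → C ⊂ x → All (Comparable C) xs → Descending (x ∷ insert C xs)
  insert-below {xs = []} _ C⊂x _ = C⊂x ∷ [-]
  insert-below {C} {xs = y ∷ ys} (y⊂x ∷ descending) C⊂x (comparable ∷ comparables) with y ⊂? C
  ... | yes y⊂C = C⊂x ∷ y⊂C ∷ descending
  ... | no  y⊄C = y⊂x ∷ insert-below descending (above-of comparable y⊄C) comparables

  insert-descending : ∀ {C xs} → Descending xs → All (Comparable C) xs → Descending (insert C xs)
  insert-descending {xs = []} _ _ = [-]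
  insert-descending {C} {x ∷ xs} descending (comparable ∷ comparables) with x ⊂? C
  ... | yes x⊂C = x⊂C ∷ descending
  ... | no  x⊄C = insert-below descending (above-of comparable x⊄C) comparables

  ∈-insert⁺ : ∀ {C Z} xs → Z ∈ˡ xs → Z ∈ˡ insert C xs
  ∈-insert⁺ {C} (x ∷ xs) Z∈ with x ⊂? C
  ... | yes _ = there Z∈
  ∈-insert⁺ (x ∷ xs) (here refl) | no _ = here refl
  ∈-insert⁺ (x ∷ xs) (there Z∈)  | no _ = there (∈-insert⁺ xs Z∈)

  ∈-insert⁻ : ∀ {C Z} xs → Z ∈ˡ insert C xs → Z ≡ C ⊎ Z ∈ˡ xs
  ∈-insert⁻ [] (here Z≡C) = inj₁ Z≡C
  ∈-insert⁻ {C} (x ∷ xs) Z∈ with x ⊂? C | Z∈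
  ... | yes _ | here Z≡C = inj₁ Z≡C
  ... | yes _ | there Z∈′ = inj₂ Z∈′
  ... | no  _ | here Z≡x = inj₂ (here Z≡x)
  ... | no  _ | there Z∈′ = Sum.map₂ there (∈-insert⁻ xs Z∈′)

  length-insert : ∀ C xs → length (insert C xs) ≡ suc (length xs)
  length-insert C [] = refl
  length-insert C (x ∷ xs) with x ⊂? C
  ... | yes _ = refl
  ... | no  _ = cong suc (length-insert C xs)

  -- sizes strictly decrease along a descending list, so it has at most n + 1 entries
  descending-length : ∀ {xs} → Descending xs → length xs ℕ.≤ suc n
  descending-length [] = ℕ.z≤n
  descending-length {x ∷ xs} descending = ℕ.s≤s (ℕ.≤-trans (below descending) (∣p∣≤n x))
    where
    below : ∀ {x xs} → Descending (x ∷ xs) → length xs ℕ.≤ ∣ x ∣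
    below [-] = ℕ.z≤n
    below (y⊂x ∷ descending) = ℕ.≤-trans (ℕ.s≤s (below descending)) (p⊂q⇒∣p∣<∣q∣ y⊂x)

  descending-lookup : ∀ {x xs} → Descending (x ∷ xs) →
    ∀ i → lookupˡ (x ∷ xs) (fsuc i) ⊂ lookupˡ (x ∷ xs) (inject₁ i)
  descending-lookup (y⊂x ∷ _)          fzero    = y⊂x
  descending-lookup (_ ∷ descending) (fsuc i) = descending-lookup descending i

  descending-tabulate : ∀ {k} (X : Fin (suc k) → Subset n) → (∀ i → X (fsuc i) ⊂ X (inject₁ i)) →
    Descending (tabulateˡ X)
  descending-tabulate {ℕ.zero} X _ = [-]
  descending-tabulate {suc k}  X decreasing = decreasing fzero ∷ descending-tabulate (X ∘ fsuc) (decreasing ∘ fsuc)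

  ∈ˡ⇒InChain : ∀ {x : Subset n} {xs Z} → Z ∈ˡ (x ∷ xs) → InChain (lookupˡ (x ∷ xs)) Z
  ∈ˡ⇒InChain Z∈ = index Z∈ , ≡.sym (lookup-index Z∈)

module _ {n} (G : Graph n) where
  open Adjacency G
  open Stars G

  module TriangularGraph {J} (T : Triangular (Ac G) J) where
    open Triangular T public

    nonadjacent : ∀ a → adj G (row a) (col a) ≡ false
    nonadjacent a = Ac≡true⇒nonadj (diagonal a)

    adjacent-later : ∀ {a b} → a < b → adj G (row a) (col b) ≡ true
    adjacent-later {a} {b} a<b = Ac≡false⇒adj (above a b a<b)

  coStar : Subset n → Subset n → Subset n
  coStar J P = J ∩ St G P

  coStar-antitone : ∀ J {P Q} → P ⊆ Q → coStar J Q ⊆ coStar J P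
  coStar-antitone J P⊆Q x∈ =
    let (x∈J , x∈StQ) = x∈p∩q⁻ J _ x∈ in x∈p∩q⁺ (x∈J , St-antitone P⊆Q x∈StQ)

  -- A strict step P ⊂ Q above a member P = St(J') of Ŝ_J: a vertex x ∈ Q \ P
  -- has a non-neighbour w ∈ J', and w is in coStar J P but not in coStar J Q.
  record Step (J P Q : Subset n) : Set where
    field
      x w    : Fin n
      x∈Q    : x ∈ Q
      w∈P*   : w ∈ coStar J P
      w∉Q*   : w ∉ coStar J Q
      nonadj : adj G x w ≡ false

  step : ∀ {J P Q} → SJ G J P → P ⊂ Q → Step J P Q
  step {J} {P} {Q} (J' , J'⊆J , refl) (_ , x , x∈Q , x∉P) = record
    { x = x ; w = w ; x∈Q = x∈Q
    ; w∈P* = x∈p∩q⁺ (J'⊆J w∈J' , St⁺ P w (λ u∈P → adj-sym (St⁻ u∈P w∈J')))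
    ; w∉Q* = λ w∈Q* → clash (St⁻ (proj₂ (x∈p∩q⁻ J _ w∈Q*)) x∈Q) (adj-sym w≁x)
    ; nonadj = adj-sym w≁x }
    where
    non-neighbour : ∃ λ w → w ∈ J' × adj G w x ≡ false
    non-neighbour = St-out J' x x∉P
    w : Fin n
    w = proj₁ non-neighbour
    w∈J' : w ∈ J'
    w∈J' = proj₁ (proj₂ non-neighbour)
    w≁x : adj G w x ≡ false
    w≁x = proj₂ (proj₂ non-neighbour)

  module Chain {J m} (chain : HasChainOfLength (SJ G J) m) where
    p : Fin (suc m) → Subset n
    p = proj₁ chain

    steps : ∀ i → Step J (p (inject₁ i)) (p (fsuc i))
    steps i = step (proj₁ (proj₂ chain) (inject₁ i)) (proj₂ (proj₂ chain) i)

    coStars-decrease : ∀ i → coStar J (p (fsuc i)) ⊂ coStar J (p (inject₁ i))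
    coStars-decrease i =
      coStar-antitone J (proj₁ (proj₂ (proj₂ chain) i)) , Step.w (steps i) , Step.w∈P* (steps i) , Step.w∉Q* (steps i)

  height-bound : ∀ {J m} → HasChainOfLength (SJ G J) m → m ℕ.≤ ∣ J ∣
  height-bound {J} chain = ℕ.≤-trans
    (countdown (λ i → ∣ coStar J (p i) ∣) (p⊂q⇒∣p∣<∣q∣ ∘ coStars-decrease))
    (p⊆q⇒∣p∣≤∣q∣ (proj₁ ∘ x∈p∩q⁻ J _))
    where open Chain chain

  -- A chain of length |J| yields a triangular system: row a is the vertex x
  -- of step a and column a the vertex w of step a.
  long-chain⇒triangular : ∀ {J} → HasChainOfLength (SJ G J) ∣ J ∣ → Triangular (Ac G) J
  long-chain⇒triangular {J} chain = record
    { size = ∣ J ∣ ; row = row ; col = col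
    ; col-enum = col-injective , λ v → injective-onto col col-injective col∈J , λ a ca≡v → subst (_∈ J) ca≡v (col∈J a)
    ; isTriangular = triangular }
    where
    open Chain chain
    row col : Fin ∣ J ∣ → Fin n
    row a = Step.x (steps a)
    col a = Step.w (steps a)
    col∈J : ∀ a → col a ∈ J
    col∈J a = proj₁ (x∈p∩q⁻ J _ (Step.w∈P* (steps a)))
    -- column b lies in coStar J p_b ⊆ coStar J p_{a+1}, and row a lies in p_{a+1}
    adjacent-later : ∀ {a b} → a < b → adj G (row a) (col b) ≡ true
    adjacent-later {a} {b} a<b =
      St⁻ (proj₂ (x∈p∩q⁻ J _ (antitone (λ i → coStar J (p i)) (proj₁ ∘ coStars-decrease) (<⇒suc≤inject₁ a<b) (Step.w∈P* (steps b)))))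
          (Step.x∈Q (steps a))
    triangular : IsTriangular (Ac G) row col
    triangular = record
      { diagonal = λ a → nonadj⇒Ac≡true (Step.nonadj (steps a))
      ; above = λ a b a<b → adj⇒Ac≡false (adjacent-later a<b) }
    col-injective : Injective _≡_ _≡_ col
    col-injective = IsTriangular.cols-injective triangular

  -- Conversely, the stars of the suffixes {col b | b ≥ a} of a triangular
  -- system form a chain of length |J| in Ŝ_J; row a enters it at step a.
  triangular⇒long-chain : ∀ {J} → Triangular (Ac G) J → HasChainOfLength (SJ G J) ∣ J ∣
  triangular⇒long-chain {J} T =
    subst (HasChainOfLength (SJ G J)) (≡.sym (enumeration-size col J col-enum)) (p , members , increasing)
    where
    open TriangularGraph T
    suffix : Fin (suc size) → Subset n
    suffix a = imageWhere col (a Fin.≤?_)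
    p : Fin (suc size) → Subset n
    p a = St G (suffix a)
    members : ∀ a → SJ G J (p a)
    members a = suffix a , ∀-imageWhere {P = _∈ J} col (a Fin.≤?_) (λ {b} _ → col∈J b) , refl
    increasing : ∀ i → p (inject₁ i) ⊂ p (fsuc i)
    increasing i = St-antitone shrink , row i , row-in , row-out
      where
      shrink : suffix (fsuc i) ⊆ suffix (inject₁ i)
      shrink = ∀-imageWhere {P = _∈ suffix (inject₁ i)} col (fsuc i Fin.≤?_) λ i<b →
        ∈imageWhere⁺ col (inject₁ i Fin.≤?_) (subst (ℕ._≤ _) (≡.sym (Fin.toℕ-inject₁ i)) (ℕ.<⇒≤ i<b))
      row-in : row i ∈ p (fsuc i)
      row-in = St⁺ _ (row i) (∀-imageWhere {P = λ v → adj G v (row i) ≡ true} col (fsuc i Fin.≤?_) (adj-sym ∘ adjacent-later))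
      row-out : row i ∉ p (inject₁ i)
      row-out r∈ = clash (St⁻ r∈ (∈imageWhere⁺ col (inject₁ i Fin.≤?_) (ℕ.≤-reflexive (Fin.toℕ-inject₁ i)))) (adj-sym (nonadjacent i))

  FlatTransversal : Subset n → Set
  FlatTransversal J = Σ ℕ λ k → Σ (Fin (suc k) → Subset n) λ X → IsFlatChain G k X × IsTransversal k X J

  -- The stars of the prefixes {row a | a < i} of a triangular system form a
  -- chain of flats, transversed by the columns: column i leaves it at step i.
  triangular⇒flat-transversal : ∀ {J} → Triangular (Ac G) J → FlatTransversal J
  triangular⇒flat-transversal T =
    size , X , ((λ i → prefix i , refl) , decreasing) , col , transversal , proj₂ col-enum
    where
    open TriangularGraph T
    prefix : Fin (suc size) → Subset n
    prefix i = imageWhere row (Fin._<? i)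
    X : Fin (suc size) → Subset n
    X i = St G (prefix i)
    transversal : ∀ i → InStep X i (col i)
    transversal i =
      St⁺ _ (col i) (∀-imageWhere {P = λ v → adj G v (col i) ≡ true} row (Fin._<? inject₁ i) λ a<i → adjacent-later (subst (_ ℕ.<_) (Fin.toℕ-inject₁ i) a<i)) ,
      λ c∈ → clash (St⁻ c∈ (∈imageWhere⁺ row (Fin._<? fsuc i) (ℕ.n<1+n (toℕ i)))) (nonadjacent i)
    decreasing : ∀ i → X (fsuc i) ⊂ X (inject₁ i)
    decreasing i = St-antitone grow , col i , transversal i
      where
      grow : prefix (inject₁ i) ⊆ prefix (fsuc i)
      grow = ∀-imageWhere {P = _∈ prefix (fsuc i)} row (Fin._<? inject₁ i) λ a<i →
        ∈imageWhere⁺ row (Fin._<? fsuc i) (ℕ.m<n⇒m<1+n (subst (_ ℕ.<_) (Fin.toℕ-inject₁ i) a<i))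

  -- A transversal y of a chain of flats Xᵢ = St(Wᵢ) gives a triangular system:
  -- y_a ∉ St(W_{a+1}) has a non-neighbour r_a ∈ W_{a+1}, while every later y_b
  -- lies in X_{a+1} = St(W_{a+1}) and so is adjacent to r_a.
  flat-transversal⇒triangular : ∀ {J} → FlatTransversal J → Triangular (Ac G) J
  flat-transversal⇒triangular (k , X , (flat , decreasing) , y , transversal , y-image) = record
    { size = k ; row = row ; col = y
    ; col-enum = IsTriangular.cols-injective triangular , y-image
    ; isTriangular = triangular }
    where
    W : Fin (suc k) → Subset n
    W i = proj₁ (flat i)
    non-neighbour : ∀ i → ∃ λ w → w ∈ W (fsuc i) × adj G w (y i) ≡ false
    non-neighbour i = St-out (W (fsuc i)) (y i) (proj₂ (transversal i) ∘ subst (y i ∈_) (proj₂ (flat (fsuc i))))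
    row : Fin k → Fin n
    row i = proj₁ (non-neighbour i)
    adjacent-later : ∀ {a b} → a < b → adj G (row a) (y b) ≡ true
    adjacent-later {a} {b} a<b = St⁻ (subst (y b ∈_) (≡.sym (proj₂ (flat (fsuc a)))) yb∈X) (proj₁ (proj₂ (non-neighbour a)))
      where
      yb∈X : y b ∈ X (fsuc a)
      yb∈X = antitone X (proj₁ ∘ decreasing) (<⇒suc≤inject₁ a<b) (proj₁ (transversal b))
    triangular : IsTriangular (Ac G) row y
    triangular = record
      { diagonal = λ a → nonadj⇒Ac≡true (proj₂ (proj₂ (non-neighbour a)))
      ; above = λ a b a<b → adj⇒Ac≡false (adjacent-later a<b) }

module _ {n} (G : Graph n) where

  Saturated : (Subset n → Set) → Set
  Saturated Member = ¬ ∃ λ W → ∀ {Z} → Member Z → Comparable (St G W) Z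

  -- A chain of flats to which no flat can be added is maximal: a member Y_j of
  -- a chain through all X_i that is not itself some X_i is a flat comparable
  -- with every X_i.
  saturated⇒maximal : ∀ {k} (X : Fin (suc k) → Subset n) → IsFlatChain G k X → Saturated (InChain X) →
    IsMaximalFlatChain G k X
  saturated⇒maximal X chain saturated = chain , maximal
    where
    maximal : ∀ l Y → IsFlatChain G l Y → (∀ i → ∃ λ j → Y j ≡ X i) → ∀ j → ∃ λ i → X i ≡ Y j
    maximal l Y (flatY , decreasingY) covers j with any? (λ i → ≡-dec Bool._≟_ (X i) (Y j))
    ... | yes found  = found
    ... | no missing = contradiction (proj₁ (flatY j) , λ {Z} → comparable {Z}) saturated
      where
      Yj≡St : Y j ≡ St G (proj₁ (flatY j))
      Yj≡St = ≡.sym (proj₂ (flatY j))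
      comparable : ∀ {Z} → InChain X Z → Comparable (St G (proj₁ (flatY j))) Z
      comparable (i , refl) with covers i
      ... | j' , Yj'≡Xi with <-cmp j j'
      ... | tri< j<j' _ _ = inj₂ (subst₂ _⊂_ Yj'≡Xi Yj≡St (strictly-antitone Y decreasingY j<j'))
      ... | tri≈ _ refl _ = contradiction (i , ≡.sym Yj'≡Xi) missing
      ... | tri> _ _ j'<j = inj₁ (subst₂ _⊂_ Yj≡St Yj'≡Xi (strictly-antitone Y decreasingY j'<j))

  SeparatingFlats : Subset n → List (Subset n) → Set
  SeparatingFlats J xs = Descending xs × (∀ {Z} → Z ∈ˡ xs → IsFlat G Z) × Separates (_∈ˡ xs) J

  -- Insert flats comparable with all entries while there are any.  Each
  -- insertion lengthens the list, which has at most n + 1 entries, so the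
  -- fuel never runs out.
  saturate : ∀ {J} fuel xs → suc n ℕ.< length xs ℕ.+ fuel → SeparatingFlats J xs →
    ∃ λ ys → SeparatingFlats J ys × Saturated (_∈ˡ ys)
  saturate ℕ.zero xs too-long (descending , _) =
    contradiction (descending-length descending) (ℕ.<⇒≱ (subst (suc n ℕ.<_) (ℕ.+-identityʳ _) too-long))
  saturate (suc fuel) xs bound (descending , flat , separates)
    with anySubset? (λ W → all? (comparable? (St G W)) xs)
  ... | no none = xs , (descending , flat , separates) , λ { (W , comparable) → none (W , All.tabulate comparable) }
  ... | yes (W , comparable) =
    saturate fuel (insert (St G W) xs) bound′
      (insert-descending descending comparable , flat′ , separates-mono (∈-insert⁺ xs) separates)
    where
    bound′ : suc n ℕ.< length (insert (St G W) xs) ℕ.+ fuel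
    bound′ rewrite length-insert (St G W) xs = subst (suc n ℕ.<_) (ℕ.+-suc _ fuel) bound
    flat′ : ∀ {Z} → Z ∈ˡ insert (St G W) xs → IsFlat G Z
    flat′ Z∈ with ∈-insert⁻ xs Z∈
    ... | inj₁ refl = W , refl
    ... | inj₂ Z∈xs = flat Z∈xs

  MaximalPartialTransversal : Subset n → Set
  MaximalPartialTransversal J =
    Σ ℕ λ k → Σ (Fin (suc k) → Subset n) λ X → IsMaximalFlatChain G k X × IsPartialTransversal k X J

  transversal⇒separating-flats : ∀ {J} ((k , X , _) : FlatTransversal G J) → SeparatingFlats J (tabulateˡ X)
  transversal⇒separating-flats (k , X , (flat , decreasing) , transversal) =
    descending-tabulate X decreasing , flat-entry ,
    separates-mono entry (transversal-separated X (proj₁ ∘ decreasing) transversal)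
    where
    flat-entry : ∀ {Z} → Z ∈ˡ tabulateˡ X → IsFlat G Z
    flat-entry Z∈ with ∈-tabulate⁻ {f = X} Z∈
    ... | i , refl = flat i
    entry : ∀ {Z} → InChain X Z → Z ∈ˡ tabulateˡ X
    entry (i , refl) = ∈-tabulate⁺ {f = X} i

  -- (iv) ⇒ (v): saturating a chain of flats transversed by J gives a maximal
  -- chain that still separates J, so J is a partial transversal of it.  (The
  -- empty list is never saturated: every flat is comparable with all its entries.)
  flat-transversal⇒maximal : ∀ {J} → FlatTransversal G J → MaximalPartialTransversal J
  flat-transversal⇒maximal {J} F@(k , X , _)
    with saturate (suc (suc n)) (tabulateˡ X) (ℕ.m≤n+m _ (length (tabulateˡ X))) (transversal⇒separating-flats F)
  ... | [] , _ , saturated = ⊥-elim (saturated (Data.Fin.Subset.⊥ , λ ()))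
  ... | x ∷ xs , (descending , flat′ , separates) , saturated =
    length xs , lookupˡ (x ∷ xs) ,
    saturated⇒maximal _ ((λ i → flat′ (∈-lookup i)) , descending-lookup descending)
      (λ { (W , comparable) → saturated (W , comparable ∘ ∈ˡ⇒InChain) }) ,
    separated⇒partial-transversal _ (descending-lookup descending) (separates-mono ∈ˡ⇒InChain separates)

  -- (v) ⇒ (i): J lies in a transversal T of a chain of flats; T is independent
  -- by (iv), hence so is J.
  maximal⇒independent : ∀ {J} → MaximalPartialTransversal J → ¬ Dependent (Ac G) J
  maximal⇒independent (k , X , (chain , _) , T , transversal , J⊆T) =
    independent-⊆ (Ac G) J⊆T (triangular⇒independent (Ac G) (flat-transversal⇒triangular G (k , X , chain , transversal)))

via-triangular : ∀ {p n} {M : Matrix p n} {J} {C : Set} →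
  (Triangular M J → C) → (C → Triangular M J) → (¬ Dependent M J) ⇔ C
via-triangular {M = M} {J} to from = mk⇔ (to ∘ independent⇒triangular M J) (triangular⇒independent M ∘ from)

theorem3p1 : ∀ {n : ℕ} (G : Graph n) (J : Subset n) →
    (ColumnsIndependent G J ⇔ HasWitness G J) ×
    (ColumnsIndependent G J ⇔ HeightIs (SJ G J) ∣ J ∣) ×
    (ColumnsIndependent G J ⇔
      (Σ ℕ λ k → Σ (Fin (suc k) → Subset n) λ X → IsFlatChain G k X × IsTransversal k X J)) ×
    (ColumnsIndependent G J ⇔
      (Σ ℕ λ k → Σ (Fin (suc k) → Subset n) λ X → IsMaximalFlatChain G k X × IsPartialTransversal k X J))
theorem3p1 G J =
  via-triangular (triangular⇒witness (Ac G)) (witness⇒triangular (Ac G)) ,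
  via-triangular (λ T → triangular⇒long-chain G T , λ _ → height-bound G) (long-chain⇒triangular G ∘ proj₁) ,
  via-triangular (triangular⇒flat-transversal G) (flat-transversal⇒triangular G) ,
  mk⇔ (flat-transversal⇒maximal G ∘ triangular⇒flat-transversal G ∘ independent⇒triangular (Ac G) J)
      (maximal⇒independent G)
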